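{- Let $\mathbb T$ be a single-sorted geometric theory over $\Sigma$ with enough $\mathbb S$-indexed models, let $\{\mathbf x.\phi\}$ be a formula-in-context, $\psi$ a geometric formula in context $\mathbf x,\mathbf y$, and $\mathbf a$ a tuple of distinct elements of $\mathbb S$ of the length of $\mathbf y$. Then the stabilization (with respect to the action $\theta$) of the subset \[\langle\{\mathbf x,\mathbf y.\psi\},\mathbf a\rangle:=\{(\mathbf M,[\mathbf b])\in[\![\mathbf x.\phi]\!]:([\mathbf b],[\mathbf a])\in[\![\mathbf x,\mathbf y.\phi\wedge\psi]\!]^{\mathbf M}\}\subseteq[\![\mathbf x.\phi]\!]\] is the subset $[\![\mathbf x.\phi\wedge\exists\mathbf y\,\psi]\!]\subseteq[\![\mathbf x.\phi]\!]$.
   Context: Fix a single-sorted signature $\Sigma$ and a set $\mathbb S$ with $|\mathbb S|\geq|\Sigma|+\aleph_0$. $M_{\mathbb T}$ is the set of $\mathbb T$-models whose underlying set is $A/{\sim}$ for some $A\subseteq\mathbb S$ and equivalence relation $\sim$ on $A$ (elements written $[a]$), and $I_{\mathbb T}$ the set of isomorphisms between them. $\mathbb T$ has enough $\mathbb S$-indexed models if every geometric sequent true in all models in $M_{\mathbb T}$ is provable in $\mathbb T$. For a formula-in-context $\{\mathbf x.\phi\}$, $[\![\mathbf x.\phi]\!]=\{(\mathbf M,[\mathbf b]):\mathbf M\in M_{\mathbb T},[\mathbf b]\in[\![\mathbf x.\phi]\!]^{\mathbf M}\}$. The action $\theta$ sends an isomorphism $\mathbf f:\mathbf M\to\mathbf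 N$ in $I_{\mathbb T}$ and $(\mathbf M,[\mathbf b])\in[\![\mathbf x.\phi]\!]$ to $(\mathbf N,\mathbf f([\mathbf b]))$. A subset is stable if it is closed under this action, and the stabilization of a subset is the least stable subset containing it. -}

module Defs where

open import Data.Nat using (ℕ; zero; suc; _+_)
open import Data.Fin using (Fin; _↑ˡ_; _↑ʳ_; splitAt; _≟_)
open import Data.Sum using (_⊎_; inj₁; inj₂)
open import Data.Product using (Σ; _×_; _,_; proj₁; proj₂)
open import Data.Unit using (⊤)
open import Data.Vec.Functional using (_++_)
open import Function using (_∘_)
open import Relation.Nullary using (yes; no)

record Signature : Set₁ where
  field
    Fun   : Set
    funAr : Fun → ℕ
    Rel   : Set
    relAr : Rel → ℕ

module _ (Sig : Signature) where
  open Signature Sig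

  -- Disjunctions are infinitary (indexed by an
  -- arbitrary set I); the empty disjunction is ⊥.  The existential
  -- ∃ᶠ m φ binds a block of m variables y, placed after the context x,
  -- i.e. φ is in context x,y.

  data Term (n : ℕ) : Set where
    var : Fin n → Term n
    app : (f : Fun) → (Fin (funAr f) → Term n) → Term n

  infixr 6 _∧ᶠ_
  infix 7 _≐_

  data Formula : ℕ → Set₁ where
    relᶠ : ∀ {n} (R : Rel) → (Fin (relAr R) → Term n) → Formula n
    _≐_  : ∀ {n} → Term n → Term n → Formula n
    ⊤ᶠ   : ∀ {n} → Formula n
    _∧ᶠ_ : ∀ {n} → Formula n → Formula n → Formula n
    ⋁    : ∀ {n} (I : Set) → (I → Formula n) → Formula n
    ∃ᶠ   : ∀ {n} (m : ℕ) → Formula (n + m) → Formula n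

  substT : ∀ {n k} → (Fin n → Term k) → Term n → Term k
  substT σ (var i)    = σ i
  substT σ (app f ts) = app f (λ j → substT σ (ts j))

  liftS : ∀ {n k} (m : ℕ) → (Fin n → Term k) → Fin (n + m) → Term (k + m)
  liftS {n} {k} m σ i with splitAt n i
  ... | inj₁ j = substT (λ l → var (l ↑ˡ m)) (σ j)
  ... | inj₂ j = var (k ↑ʳ j)

  substF : ∀ {n k} → (Fin n → Term k) → Formula n → Formula k
  substF σ (relᶠ R ts) = relᶠ R (λ j → substT σ (ts j))
  substF σ (s ≐ t)    = substT σ s ≐ substT σ t
  substF σ ⊤ᶠ         = ⊤ᶠ
  substF σ (φ ∧ᶠ ψ)   = substF σ φ ∧ᶠ substF σ ψ
  substF σ (⋁ I φs)   = ⋁ I (λ i → substF σ (φs i))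
  substF σ (∃ᶠ m φ)   = ∃ᶠ m (substF (liftS m σ) φ)

  wk : ∀ {n} (m : ℕ) → Formula n → Formula (n + m)
  wk m = substF (λ i → var (i ↑ˡ m))

  replaceVar : ∀ {n} → Fin n → Fin n → Fin n → Term n
  replaceVar i j l with l ≟ i
  ... | yes _ = var j
  ... | no  _ = var l

  -- Geometric theories (sets of geometric sequents φ ⊢_x ψ) and the
  -- geometric deduction system (Johnstone, Elephant D1.3.1).

  Theory : Set₂
  Theory = (n : ℕ) → Formula n → Formula n → Set₁

  data Pf (T : Theory) : (n : ℕ) → Formula n → Formula n → Set₂ where
    axiom   : ∀ {n φ ψ} → T n φ ψ → Pf T n φ ψ
    ident   : ∀ {n φ} → Pf T n φ φ
    subst   : ∀ {n k φ ψ} (σ : Fin n → Term k) → Pf T n φ ψ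
            → Pf T k (substF σ φ) (substF σ ψ)
    cut     : ∀ {n φ ψ χ} → Pf T n φ ψ → Pf T n ψ χ → Pf T n φ χ
    eq-refl : ∀ {n} (i : Fin n) → Pf T n ⊤ᶠ (var i ≐ var i)
    eq-repl : ∀ {n} (i j : Fin n) (φ : Formula n)
            → Pf T n (var i ≐ var j ∧ᶠ φ) (substF (replaceVar i j) φ)
    ⊤-intro : ∀ {n φ} → Pf T n φ ⊤ᶠ
    ∧-elimˡ : ∀ {n φ ψ} → Pf T n (φ ∧ᶠ ψ) φ
    ∧-elimʳ : ∀ {n φ ψ} → Pf T n (φ ∧ᶠ ψ) ψ
    ∧-intro : ∀ {n φ ψ χ} → Pf T n φ ψ → Pf T n φ χ → Pf T n φ (ψ ∧ᶠ χ)
    ⋁-intro : ∀ {n I φs} (i : I) → Pf T n (φs i) (⋁ I φs)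
    ⋁-elim  : ∀ {n I φs ψ} → ((i : I) → Pf T n (φs i) ψ) → Pf T n (⋁ I φs) ψ
    ∃-elim  : ∀ {n m φ ψ} → Pf T (n + m) φ (wk m ψ) → Pf T n (∃ᶠ m φ) ψ
    ∃-intro : ∀ {n m φ ψ} → Pf T n (∃ᶠ m φ) ψ → Pf T (n + m) φ (wk m ψ)
    distrib : ∀ {n φ I ψs}
            → Pf T n (φ ∧ᶠ ⋁ I ψs) (⋁ I (λ i → φ ∧ᶠ ψs i))
    frobenius : ∀ {n m φ ψ}
            → Pf T n (φ ∧ᶠ ∃ᶠ m ψ) (∃ᶠ m (wk m φ ∧ᶠ ψ))

  -- S-indexed structures: underlying set A/∼ for A ⊆ S and ∼ an
  -- equivalence relation on A.  Elements are represented by pairs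
  -- (s , s∈A); [s] = [t] iff s ∼ t.  Operations/relations are given on
  -- representatives and required to respect ∼ (i.e. they are functions
  -- and relations on A/∼).

  module _ (S : Set) where

    record Structure : Set₁ where
      field
        A       : S → Set
        _∼_     : S → S → Set
        ∼-dom   : ∀ {s t} → s ∼ t → A s × A t
        ∼-refl  : ∀ {s} → A s → s ∼ s
        ∼-sym   : ∀ {s t} → s ∼ t → t ∼ s
        ∼-trans : ∀ {s t u} → s ∼ t → t ∼ u → s ∼ u

      Carrier : Set
      Carrier = Σ S A

      _≈_ : Carrier → Carrier → Set
      x ≈ y = proj₁ x ∼ proj₁ y

      field
        fun      : (f : Fun) → (Fin (funAr f) → Carrier) → Carrier
        fun-cong : ∀ f {xs ys} → (∀ i → xs i ≈ ys i) → fun f xs ≈ fun f ys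
        rel      : (R : Rel) → (Fin (relAr R) → Carrier) → Set
        rel-cong : ∀ R {xs ys} → (∀ i → xs i ≈ ys i) → rel R xs → rel R ys

    open Structure public

    evalT : ∀ {n} (M : Structure) → (Fin n → Carrier M) → Term n → Carrier M
    evalT M ρ (var i)    = ρ i
    evalT M ρ (app f ts) = fun M f (λ j → evalT M ρ (ts j))

    sat : ∀ {n} (M : Structure) → Formula n → (Fin n → Carrier M) → Set
    sat M (relᶠ R ts) ρ = rel M R (λ j → evalT M ρ (ts j))
    sat M (s ≐ t)    ρ = _≈_ M (evalT M ρ s) (evalT M ρ t)
    sat M ⊤ᶠ         ρ = ⊤
    sat M (φ ∧ᶠ ψ)   ρ = sat M φ ρ × sat M ψ ρ
    sat M (⋁ I φs)   ρ = Σ I (λ i → sat M (φs i) ρ)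
    sat M (∃ᶠ m φ)   ρ = Σ (Fin m → Carrier M) (λ d → sat M φ (ρ ++ d))

    IsModel : Theory → Structure → Set₁
    IsModel T M = ∀ n φ ψ → T n φ ψ → ∀ ρ → sat M φ ρ → sat M ψ ρ

    record ModelOf (T : Theory) : Set₁ where
      field
        struct  : Structure
        isModel : IsModel T struct

    open ModelOf public

    EnoughModels : Theory → Set₂
    EnoughModels T = ∀ n φ ψ
      → (∀ (M : ModelOf T) ρ → sat (struct M) φ ρ → sat (struct M) ψ ρ)
      → Pf T n φ ψ

    record Iso (M N : Structure) : Set where
      field
        map      : Carrier M → Carrier N
        map-cong : ∀ {x y} → _≈_ M x y → _≈_ N (map x) (map y)
        map-inj  : ∀ {x y} → _≈_ N (map x) (map y) → _≈_ M x y
        map-surj : ∀ y → Σ (Carrier M) (λ x → _≈_ N (map x) y)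
        map-fun  : ∀ f xs → _≈_ N (map (fun M f xs)) (fun N f (λ i → map (xs i)))
        map-rel  : ∀ R xs → rel M R xs → rel N R (λ i → map (xs i))
        map-rel⁻ : ∀ R xs → rel N R (λ i → map (xs i)) → rel M R xs

    open Iso public

    -- Subsets of [[x.φ]] = {(M,[b]) : M ∈ M_T, [b] ∈ [[x.φ]]^M}.
    -- A subset is a predicate on pairs (M , b) that is invariant under
    -- changing representatives of [b].

    module _ (T : Theory) {n : ℕ} where

      SubPred : Set₁
      SubPred = (M : ModelOf T) → (Fin n → Carrier (struct M)) → Set

      RespectsClasses : SubPred → Set₁
      RespectsClasses P = ∀ M b c → (∀ i → _≈_ (struct M) (b i) (c i)) → P M b → P M c

      _⊆_ : SubPred → SubPred → Set₁
      P ⊆ Q = ∀ M b → P M b → Q M b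

      ⟦_⟧ : Formula n → SubPred
      ⟦ φ ⟧ M b = sat (struct M) φ b

      IsSubsetOf⟦_⟧ : Formula n → SubPred → Set₁
      IsSubsetOf⟦ φ ⟧ P = RespectsClasses P × (P ⊆ ⟦ φ ⟧)

      -- closed under the action θ : (f : M ≅ N , (M,[b])) ↦ (N , f[b])
      Stable : SubPred → Set₁
      Stable P = ∀ M N (f : Iso (struct M) (struct N)) b → P M b → P N (λ i → map f (b i))

      IsStabilization : Formula n → SubPred → SubPred → Set₁
      IsStabilization φ P Q =
        IsSubsetOf⟦ φ ⟧ Q × Stable Q × (P ⊆ Q)
        × (∀ R → IsSubsetOf⟦ φ ⟧ R → Stable R → P ⊆ R → Q ⊆ R)

      ⟨_,_⟩[_] : ∀ {m} → Formula (n + m) → (Fin m → S) → Formula n → SubPred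
      ⟨_,_⟩[_] {m} ψ a φ M b =
        sat (struct M) φ b
        × Σ ((i : Fin m) → A (struct M) (a i))
            (λ a∈M → sat (struct M) (wk m φ ∧ᶠ ψ) (b ++ (λ i → a i , a∈M i)))

module Submission where

open import Defs
open import Level using (0ℓ)
open import Data.Nat using (ℕ; _+_)
open import Data.Fin using (Fin)
open import Data.Sum using (_⊎_)
open import Function.Bundles using (_↣_)
open import Function.Definitions using (Injective)
open import Relation.Binary.PropositionalEquality using (_≡_)
open import Axiom.ExcludedMiddle using (ExcludedMiddle)

open import Data.Nat using (zero; suc; _<_; _≤_)
open import Data.Nat.Properties
  using (+-cancelˡ-≡; m≤m+n; m≤n+m; <-≤-trans; ≤-trans; +-monoʳ-<; <⇒≢; ≤⇒≯)
open import Data.Fin using (toℕ; _↑ˡ_; splitAt) renaming (zero to fzero; suc to fsuc)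
open import Data.Fin.Properties using (toℕ-injective; toℕ<n)
open import Data.Product using (Σ; _×_; _,_; proj₁; proj₂)
open import Data.Sum using (inj₁; inj₂)
open import Data.Sum.Properties using (inj₂-injective)
open import Data.Empty using (⊥-elim)
open import Data.Unit using (tt)
open import Data.Vec.Functional using (_++_)
open import Data.Vec.Functional.Properties using (lookup-++ˡ; lookup-++ʳ)
open import Data.Vec.Functional.Relation.Binary.Pointwise using (Pointwise)
open import Data.Vec.Functional.Relation.Binary.Pointwise.Properties using (++⁺)
open import Relation.Nullary using (yes; no; ¬_)
open import Relation.Binary.PropositionalEquality using (_≢_; refl; sym; trans; cong)
open import Function using (_∘_)
open import Function.Bundles using (Injection)

-- The subset ⟦x. φ ∧ ∃y ψ⟧ is class-respecting and
-- stable, since satisfaction of formulas is transported along isomorphisms,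
-- and it obviously contains ⟨{x,y.ψ}, a⟩.  It is the least such subset because
-- each of its points (M , [b]) is in the θ-orbit of a point of ⟨{x,y.ψ}, a⟩:
-- if M ⊨ ψ(b, d), relabel the elements of M so that the labels a name the
-- witnesses d; the relabelled copy N ≅ M is again a model of T and
-- (N , [b]) ∈ ⟨{x,y.ψ}, a⟩.  Relabelling needs labels in S away from the
-- finite tuple a; a Hilbert-hotel injection S → S avoiding a is obtained from
-- the copy of ℕ inside S by excluded middle.

-- (1) Hilbert's hotel: room for fresh labels in S.

codeBound : {S : Set} → ExcludedMiddle 0ℓ → (e : ℕ → S) → Injective _≡_ _≡_ e
          → {m : ℕ} (a : Fin m → S) → Σ ℕ λ B → ∀ i k → e k ≡ a i → k < B
codeBound em e e-inj {zero} a = 0 , λ ()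
codeBound em e e-inj {suc m} a
  with codeBound em e e-inj (a ∘ fsuc) | em {Σ ℕ λ k → e k ≡ a fzero}
... | B , below | no notCode = B , bound
  where
  bound : ∀ i k → e k ≡ a i → k < B
  bound fzero    k p = ⊥-elim (notCode (k , p))
  bound (fsuc i) k p = below i k p
... | B , below | yes (k₀ , p₀) = B + suc k₀ , bound
  where
  bound : ∀ i k → e k ≡ a i → k < B + suc k₀
  bound fzero    k p rewrite e-inj (trans p (sym p₀)) = m≤n+m (suc k₀) B
  bound (fsuc i) k p = <-≤-trans (below i k p) (m≤m+n B (suc k₀))

record AvoidingInjection {S : Set} {m : ℕ} (a : Fin m → S) : Set where
  field
    hop       : S → S
    hop-inj   : Injective _≡_ _≡_ hop
    hop-avoid : ∀ s i → hop s ≢ a i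

-- If S contains a copy of ℕ, every finite tuple is avoided by some injection
-- S → S: codes and entries of a are moved to fresh codes, all else is fixed.
module HilbertHotel {S : Set} (em : ExcludedMiddle 0ℓ)
                    (e : ℕ → S) (e-inj : Injective _≡_ _≡_ e)
                    {m : ℕ} (a : Fin m → S) where

  B : ℕ
  B = proj₁ (codeBound em e e-inj a)

  data Moved (s : S) : Set where
    code  : (k : ℕ) → e k ≡ s → Moved s
    entry : (i : Fin m) → a i ≡ s → Moved s

  slot : ∀ {s} → Moved s → ℕ
  slot (code k _)  = B + m + k
  slot (entry i _) = B + toℕ i

  B≤slot : ∀ {s} (μ : Moved s) → B ≤ slot μ
  B≤slot (code k _)  = ≤-trans (m≤m+n B m) (m≤m+n (B + m) k)
  B≤slot (entry i _) = m≤m+n B (toℕ i)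

  entry<code : ∀ (i : Fin m) k → B + toℕ i < B + m + k
  entry<code i k = <-≤-trans (+-monoʳ-< B (toℕ<n i)) (m≤m+n (B + m) k)

  slot-inj : ∀ {s s'} (μ : Moved s) (μ' : Moved s') → slot μ ≡ slot μ' → s ≡ s'
  slot-inj (code k p) (code k' p') q =
    trans (sym p) (trans (cong e (+-cancelˡ-≡ (B + m) k k' q)) p')
  slot-inj (entry i p) (entry j p') q =
    trans (sym p) (trans (cong a (toℕ-injective (+-cancelˡ-≡ B (toℕ i) (toℕ j) q))) p')
  slot-inj (code k _) (entry i _) q = ⊥-elim (<⇒≢ (entry<code i k) (sym q))
  slot-inj (entry i _) (code k _) q = ⊥-elim (<⇒≢ (entry<code i k) q)

  data Kind (s : S) : Set where
    moved : Moved s → Kind s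
    fixed : ¬ (Σ ℕ λ k → e k ≡ s) → ¬ (Σ (Fin m) λ i → a i ≡ s) → Kind s

  kind : (s : S) → Kind s
  kind s with em {Σ ℕ λ k → e k ≡ s} | em {Σ (Fin m) λ i → a i ≡ s}
  ... | yes (k , p) | _           = moved (code k p)
  ... | no _        | yes (i , p) = moved (entry i p)
  ... | no notCode  | no notEntry = fixed notCode notEntry

  hopKind : ∀ {s} → Kind s → S
  hopKind (moved μ)       = e (slot μ)
  hopKind {s} (fixed _ _) = s

  hopKind-inj : ∀ {s s'} (κ : Kind s) (κ' : Kind s') → hopKind κ ≡ hopKind κ' → s ≡ s'
  hopKind-inj (moved μ)         (moved μ')        q = slot-inj μ μ' (e-inj q)
  hopKind-inj (moved μ)         (fixed notCode _) q = ⊥-elim (notCode (slot μ , q))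
  hopKind-inj (fixed notCode _) (moved μ')        q = ⊥-elim (notCode (slot μ' , sym q))
  hopKind-inj (fixed _ _)       (fixed _ _)       q = q

  hopKind-avoid : ∀ {s} (κ : Kind s) i → hopKind κ ≢ a i
  hopKind-avoid (moved μ) i q =
    ≤⇒≯ (B≤slot μ) (proj₂ (codeBound em e e-inj a) i (slot μ) q)
  hopKind-avoid (fixed _ notEntry) i q = notEntry (i , sym q)

  avoidingInjection : AvoidingInjection a
  avoidingInjection = record
    { hop       = λ s → hopKind (kind s)
    ; hop-inj   = λ {s} {s'} → hopKind-inj (kind s) (kind s')
    ; hop-avoid = λ s → hopKind-avoid (kind s)
    }

module _ {Sig : Signature} {S : Set} where

  -- (2) Satisfaction is invariant under isomorphisms and substitutions.

  ≈-refl : (M : Structure Sig S) (x : Carrier M) → _≈_ M x x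
  ≈-refl M x = ∼-refl M (proj₂ x)

  ≡⇒≈ : (M : Structure Sig S) {x y : Carrier M} → x ≡ y → _≈_ M x y
  ≡⇒≈ M {x} refl = ≈-refl M x

  identityIso : (M : Structure Sig S) → Iso Sig S M M
  identityIso M = record
    { map = λ x → x ; map-cong = λ p → p ; map-inj = λ p → p
    ; map-surj = λ y → y , ≈-refl M y
    ; map-fun = λ f xs → ≈-refl M (fun M f xs)
    ; map-rel = λ R xs p → p ; map-rel⁻ = λ R xs p → p }

  module _ {M N : Structure Sig S} (f : Iso Sig S M N) where

    Sends : Carrier M → Carrier N → Set
    Sends x y = _≈_ N (map f x) y

    transportTerm : ∀ {n} {ρ : Fin n → Carrier M} {σ : Fin n → Carrier N}
      → Pointwise Sends ρ σ → ∀ t → Sends (evalT Sig S M ρ t) (evalT Sig S N σ t)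
    transportTerm ρ↦σ (var i)    = ρ↦σ i
    transportTerm ρ↦σ (app g ts) =
      ∼-trans N (map-fun f g _) (fun-cong N g (λ j → transportTerm ρ↦σ (ts j)))

    transport : ∀ {n} (φ : Formula Sig n) {ρ : Fin n → Carrier M} {σ : Fin n → Carrier N}
      → Pointwise Sends ρ σ → sat Sig S M φ ρ → sat Sig S N φ σ
    transport (relᶠ R ts) ρ↦σ p =
      rel-cong N R (λ j → transportTerm ρ↦σ (ts j)) (map-rel f R _ p)
    transport (s ≐ t) ρ↦σ p =
      ∼-trans N (∼-sym N (transportTerm ρ↦σ s))
                (∼-trans N (map-cong f p) (transportTerm ρ↦σ t))
    transport ⊤ᶠ       ρ↦σ _       = tt
    transport (φ ∧ᶠ ψ) ρ↦σ (p , q) = transport φ ρ↦σ p , transport ψ ρ↦σ q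
    transport (⋁ I φs) ρ↦σ (i , p) = i , transport (φs i) ρ↦σ p
    transport (∃ᶠ m φ) ρ↦σ (d , p) =
      map f ∘ d , transport φ (++⁺ Sends ρ↦σ (λ j → ≈-refl N (map f (d j)))) p

  module _ (M : Structure Sig S) where

    private
      _≈M_ : Carrier M → Carrier M → Set
      _≈M_ = _≈_ M
      ev : ∀ {n} → (Fin n → Carrier M) → Term Sig n → Carrier M
      ev = evalT Sig S M

    substTerm : ∀ {n k} (σ : Fin n → Term Sig k) {ρ : Fin k → Carrier M} {τ}
      → (∀ i → τ i ≈M ev ρ (σ i)) → ∀ t → ev τ t ≈M ev ρ (substT Sig σ t)
    substTerm σ τ≈ (var i)    = τ≈ i
    substTerm σ τ≈ (app g ts) = fun-cong M g (λ j → substTerm σ τ≈ (ts j))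

    weakenVar : ∀ {n m} (ρ : Fin n → Carrier M) (d : Fin m → Carrier M) i
      → ρ i ≈M ev (ρ ++ d) (var (i ↑ˡ m))
    weakenVar ρ d i = ≡⇒≈ M (sym (lookup-++ˡ ρ d i))

    substitution : ∀ {n k} (φ : Formula Sig n) (σ : Fin n → Term Sig k)
      {ρ : Fin k → Carrier M} {τ} → (∀ i → τ i ≈M ev ρ (σ i))
      → sat Sig S M φ τ → sat Sig S M (substF Sig σ φ) ρ
    substitution (relᶠ R ts) σ τ≈ p = rel-cong M R (λ j → substTerm σ τ≈ (ts j)) p
    substitution (s ≐ t) σ τ≈ p =
      ∼-trans M (∼-sym M (substTerm σ τ≈ s)) (∼-trans M p (substTerm σ τ≈ t))
    substitution ⊤ᶠ       σ τ≈ _       = tt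
    substitution (φ ∧ᶠ ψ) σ τ≈ (p , q) = substitution φ σ τ≈ p , substitution ψ σ τ≈ q
    substitution (⋁ I φs) σ τ≈ (i , p) = i , substitution (φs i) σ τ≈ p
    substitution {n} (∃ᶠ m φ) σ {ρ} {τ} τ≈ (d , p) =
      d , substitution φ (liftS Sig m σ) lifted p
      where
      lifted : ∀ i → (τ ++ d) i ≈M ev (ρ ++ d) (liftS Sig m σ i)
      lifted i with splitAt n i
      ... | inj₁ j = ∼-trans M (τ≈ j) (substTerm _ (weakenVar ρ d) (σ j))
      ... | inj₂ j = ≡⇒≈ M (sym (lookup-++ʳ ρ d j))

    weakening : ∀ {n} m (φ : Formula Sig n) {ρ : Fin n → Carrier M} (d : Fin m → Carrier M)
      → sat Sig S M φ ρ → sat Sig S M (wk Sig m φ) (ρ ++ d)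
    weakening m φ {ρ} d = substitution φ _ (weakenVar ρ d)

  -- (3) Isomorphisms have inverses; models are closed under isomorphism.

  module _ {M N : Structure Sig S} (f : Iso Sig S M N) where

    private
      g : Carrier N → Carrier M
      g y = proj₁ (map-surj f y)

    after-inverse : ∀ y → _≈_ N (map f (g y)) y
    after-inverse y = proj₂ (map-surj f y)

    inverse-after : ∀ x → _≈_ M (g (map f x)) x
    inverse-after x = map-inj f (after-inverse (map f x))

    inverse : Iso Sig S N M
    inverse = record
      { map      = g
      ; map-cong = λ {y} {y'} y≈y' →
          map-inj f (∼-trans N (after-inverse y) (∼-trans N y≈y' (∼-sym N (after-inverse y'))))
      ; map-inj  = λ {y} {y'} gy≈gy' →
          ∼-trans N (∼-sym N (after-inverse y)) (∼-trans N (map-cong f gy≈gy') (after-inverse y'))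
      ; map-surj = λ x → map f x , inverse-after x
      ; map-fun  = λ F ys → map-inj f
          (∼-trans N (after-inverse (fun N F ys))
            (∼-trans N (fun-cong N F (λ i → ∼-sym N (after-inverse (ys i))))
              (∼-sym N (map-fun f F (g ∘ ys)))))
      ; map-rel  = λ R ys p →
          map-rel⁻ f R (g ∘ ys) (rel-cong N R (λ i → ∼-sym N (after-inverse (ys i))) p)
      ; map-rel⁻ = λ R ys p → rel-cong N R (after-inverse ∘ ys) (map-rel f R (g ∘ ys) p)
      }

  isModel-transport : (T : Theory Sig) {M N : Structure Sig S} → Iso Sig S M N
    → IsModel Sig S T M → IsModel Sig S T N
  isModel-transport T {M} f isM k φ ψ ax ρ φρ =
    transport f ψ (after-inverse f ∘ ρ)
      (isM k φ ψ ax _ (transport (inverse f) φ (λ i → ≈-refl M (map (inverse f) (ρ i))) φρ))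

  -- (4) Stabilizations are detected by orbits.

  module _ (T : Theory Sig) {n : ℕ} where

    ⟦⟧-respects : (χ : Formula Sig n) → RespectsClasses Sig S T (⟦_⟧ Sig S T χ)
    ⟦⟧-respects χ M b c b≈c = transport (identityIso (struct M)) χ b≈c

    ⟦⟧-stable : (χ : Formula Sig n) → Stable Sig S T (⟦_⟧ Sig S T χ)
    ⟦⟧-stable χ M N f b = transport f χ (λ i → ≈-refl (struct N) (map f (b i)))

    record InOrbitOf (P : SubPred Sig S T) (M : ModelOf Sig S T)
                     (b : Fin n → Carrier (struct M)) : Set₁ where
      field
        source : ModelOf Sig S T
        iso    : Iso Sig S (struct source) (struct M)
        point  : Fin n → Carrier (struct source)
        inP    : P source point
        hits   : ∀ i → _≈_ (struct M) (map iso (point i)) (b i)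

    stabilization-via-orbits : (φ : Formula Sig n) (P Q : SubPred Sig S T)
      → IsSubsetOf⟦_⟧ Sig S T φ Q → Stable Sig S T Q → _⊆_ Sig S T P Q
      → (∀ M b → Q M b → InOrbitOf P M b)
      → IsStabilization Sig S T φ P Q
    stabilization-via-orbits φ P Q Q⊆φ Q-stable P⊆Q orbit =
      Q⊆φ , Q-stable , P⊆Q , least
      where
      least : ∀ R → IsSubsetOf⟦_⟧ Sig S T φ R → Stable Sig S T R
            → _⊆_ Sig S T P R → _⊆_ Sig S T Q R
      least R (R-respects , _) R-stable P⊆R M b Mb = R-respects M _ b hits
        (R-stable source M iso point (P⊆R source point inP))
        where open InOrbitOf (orbit M b Mb)

  -- (5) Relabelled copies naming a tuple of elements.

  record NamedCopy (T : Theory Sig) (M : ModelOf Sig S T) {m : ℕ}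
                   (a : Fin m → S) (d : Fin m → Carrier (struct M)) : Set₁ where
    field
      copy     : ModelOf Sig S T
      copy≅    : Iso Sig S (struct copy) (struct M)
      labelled : ∀ i → A (struct copy) (a i)
      names    : ∀ i → _≈_ (struct M) (map copy≅ (a i , labelled i)) (d i)

  -- The copy: a label s stands either for d i (s = a i) or for t ∈ M (s = hop t).
  module Relabelling {m : ℕ} {a : Fin m → S} (a-inj : Injective _≡_ _≡_ a)
                     (hotel : AvoidingInjection a)
                     (M : Structure Sig S) (d : Fin m → Carrier M) where
    open AvoidingInjection hotel

    Label : S → Set
    Label s = (Σ (Fin m) λ i → a i ≡ s) ⊎ (Σ S λ t → hop t ≡ s × A M t)

    meaning : ∀ {s} → Label s → Carrier M
    meaning (inj₁ (i , _))        = d i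
    meaning (inj₂ (t , _ , t∈M)) = t , t∈M

    -- a label has one meaning, because a is injective, hop is injective and
    -- hop avoids a
    meaning-unique : ∀ {s} (p q : Label s) → _≈_ M (meaning p) (meaning q)
    meaning-unique (inj₁ (i , refl)) (inj₁ (j , q)) with a-inj q
    ... | refl = ≈-refl M (d i)
    meaning-unique (inj₁ (i , refl)) (inj₂ (t , q , _)) = ⊥-elim (hop-avoid t i q)
    meaning-unique (inj₂ (t , refl , _)) (inj₁ (i , q)) = ⊥-elim (hop-avoid t i (sym q))
    meaning-unique (inj₂ (t , refl , t∈M)) (inj₂ (t' , q , _)) with hop-inj q
    ... | refl = ∼-refl M t∈M

    _∼L_ : S → S → Set
    s ∼L s' = Σ (Label s) λ p → Σ (Label s') λ q → _≈_ M (meaning p) (meaning q)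

    denote : Σ S Label → Carrier M
    denote x = meaning (proj₂ x)

    ∼L⇒≈ : ∀ {x y} → proj₁ x ∼L proj₁ y → _≈_ M (denote x) (denote y)
    ∼L⇒≈ {x} {y} (p , q , p≈q) =
      ∼-trans M (meaning-unique (proj₂ x) p) (∼-trans M p≈q (meaning-unique q (proj₂ y)))

    ≈⇒∼L : ∀ {x y} → _≈_ M (denote x) (denote y) → proj₁ x ∼L proj₁ y
    ≈⇒∼L {x} {y} x≈y = proj₂ x , proj₂ y , x≈y

    relabel : Carrier M → Σ S Label
    relabel (t , t∈M) = hop t , inj₂ (t , refl , t∈M)

    copy : Structure Sig S
    copy = record
      { A = Label ; _∼_ = _∼L_
      ; ∼-dom = λ { (p , q , _) → p , q }
      ; ∼-refl = λ p → p , p , ≈-refl M (meaning p)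
      ; ∼-sym = λ { (p , q , p≈q) → q , p , ∼-sym M p≈q }
      ; ∼-trans = λ { (p , q , p≈q) (q' , r , q'≈r) →
          p , r , ∼-trans M p≈q (∼-trans M (meaning-unique q q') q'≈r) }
      ; fun = λ F xs → relabel (fun M F (denote ∘ xs))
      ; fun-cong = λ F {xs} {ys} xs∼ys →
          ≈⇒∼L {relabel (fun M F (denote ∘ xs))} {relabel (fun M F (denote ∘ ys))}
            (fun-cong M F (λ i → ∼L⇒≈ {xs i} {ys i} (xs∼ys i)))
      ; rel = λ R xs → rel M R (denote ∘ xs)
      ; rel-cong = λ R {xs} {ys} xs∼ys → rel-cong M R (λ i → ∼L⇒≈ {xs i} {ys i} (xs∼ys i))
      }

    copy≅ : Iso Sig S copy M
    copy≅ = record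
      { map      = denote
      ; map-cong = λ {x} {y} → ∼L⇒≈ {x} {y}
      ; map-inj  = λ {x} {y} → ≈⇒∼L {x} {y}
      ; map-surj = λ y → relabel y , ≈-refl M y
      ; map-fun  = λ F xs → ≈-refl M (fun M F (denote ∘ xs))
      ; map-rel  = λ R xs p → p
      ; map-rel⁻ = λ R xs p → p
      }

  namedCopy : ∀ {m} {a : Fin m → S} → Injective _≡_ _≡_ a → AvoidingInjection a
    → (T : Theory Sig) (M : ModelOf Sig S T) (d : Fin m → Carrier (struct M))
    → NamedCopy T M a d
  namedCopy a-inj hotel T M d = record
    { copy     = record { struct  = R.copy
                        ; isModel = isModel-transport T (inverse R.copy≅) (isModel M) }
    ; copy≅    = R.copy≅
    ; labelled = λ i → inj₁ (i , refl)
    ; names    = λ i → ≈-refl (struct M) (d i)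
    }
    where module R = Relabelling a-inj hotel (struct M) d

  -- If M ⊨ φ(b) ∧ ψ(b, d), then (M , [b]) is in the orbit of ⟨{x,y.ψ}, a⟩:
  -- pull b back to a copy of M in which a names d.
  witness-orbit : (T : Theory Sig) {n m : ℕ} (φ : Formula Sig n) (ψ : Formula Sig (n + m))
    (a : Fin m → S) (M : ModelOf Sig S T) (b : Fin n → Carrier (struct M))
    (d : Fin m → Carrier (struct M))
    → sat Sig S (struct M) φ b → sat Sig S (struct M) ψ (b ++ d) → NamedCopy T M a d
    → InOrbitOf T (⟨_,_⟩[_] Sig S T ψ a φ) M b
  witness-orbit T {n} {m} φ ψ a M b d φb ψbd named = record
    { source = copy
    ; iso    = copy≅
    ; point  = c
    ; inP    = transport g φ (λ i → ≈-refl N (c i)) φb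
             , labelled
             , transport g (wk Sig m φ ∧ᶠ ψ) (++⁺ (Sends g) (λ i → ≈-refl N (c i)) d↦a)
                 (weakening (struct M) m φ d φb , ψbd)
    ; hits   = after-inverse copy≅ ∘ b
    }
    where
    open NamedCopy named
    N : Structure Sig S
    N = struct copy
    g : Iso Sig S (struct M) N
    g = inverse copy≅
    c : Fin n → Carrier N
    c = map g ∘ b
    d↦a : ∀ j → Sends g (d j) (a j , labelled j)
    d↦a j = ∼-trans N (map-cong g (∼-sym (struct M) (names j)))
                      (inverse-after copy≅ (a j , labelled j))

lemma3p11 : ExcludedMiddle 0ℓ
    → (Sig : Signature) (S : Set)
    → ((Signature.Fun Sig ⊎ Signature.Rel Sig) ⊎ ℕ) ↣ S
    → (T : Theory Sig) → EnoughModels Sig S T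
    → {n m : ℕ} (φ : Formula Sig n) (ψ : Formula Sig (n + m))
    → (a : Fin m → S) → Injective _≡_ _≡_ a
    → IsStabilization Sig S T φ
    (⟨_,_⟩[_] Sig S T ψ a φ)
    (⟦_⟧ Sig S T (φ ∧ᶠ ∃ᶠ m ψ))
lemma3p11 em Sig S embed T _ {m = m} φ ψ a a-inj =
  stabilization-via-orbits T φ _ _
    (⟦⟧-respects T (φ ∧ᶠ ∃ᶠ m ψ) , λ M b → proj₁)
    (⟦⟧-stable T (φ ∧ᶠ ∃ᶠ m ψ))
    contains
    (λ { M b (φb , d , ψbd) → witness-orbit T φ ψ a M b d φb ψbd (namedCopy a-inj hotel T M d) })
  where
  e : ℕ → S
  e k = Injection.to embed (inj₂ k)

  hotel : AvoidingInjection a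
  hotel = HilbertHotel.avoidingInjection em e (inj₂-injective ∘ Injection.injective embed) a

  contains : _⊆_ Sig S T (⟨_,_⟩[_] Sig S T ψ a φ) (⟦_⟧ Sig S T (φ ∧ᶠ ∃ᶠ m ψ))
  contains M b (φb , a∈M , _ , ψba) = φb , (λ i → a i , a∈M i) , ψba
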